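{- An oriented cycle $\vec C$ admits an oriented coloring with three colors if and only if $\lambda(\vec C)\equiv 0\pmod 3$ or $\vec C$ does not contain three consecutive arcs going in the same direction.
   Context: An oriented coloring of an oriented graph $G$ with $k$ colors is a map $\beta:V(G)\to\{1,\dots,k\}$ such that adjacent vertices receive different colors and, for every two arcs $(t,u)$ and $(v,w)$ of $G$, either $\beta(t)\ne\beta(w)$ or $\beta(u)\ne\beta(v)$. An oriented cycle of length $n\ge 3$ is a cyclic sequence of distinct vertices $v_0,\dots,v_{n-1}$ (indices mod $n$) where for each $i$ exactly one of the arcs $(v_i,v_{i+1})$ (forward) or $(v_{i+1},v_i)$ (backward) is present, and there are no other arcs. $\lambda(v_i,v_{i+1})$ is $1$ for a forward arc and $-1$ for a backward arc, and $\lambda(\vec C)=\sum_{i=0}^{n-1}\lambda(v_i,v_{i+1})$. "Three consecutive arcs going in the same direction" means three cyclically consecutive arcs between $v_{i-1},v_i,v_{i+1},v_{i+2}$ (indices mod $n$) that are all forward or all backward. -}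

module Defs where

open import Data.Nat using (ℕ; zero; suc; _%_)
open import Data.Nat.DivMod using (m%n<n)
open import Data.Fin using (Fin; toℕ; fromℕ<)
import Data.Fin as Fin
open import Data.Bool using (Bool; true; false)
open import Data.Integer using (ℤ; +_; -[1+_]; _+_)
open import Data.Product using (Σ; _×_)
open import Data.Sum using (_⊎_)
open import Relation.Binary.PropositionalEquality using (_≡_; _≢_)

record IsOrientedColoring {V : Set} (Arc : V → V → Set) (k : ℕ) (β : V → Fin k) : Set where
  field
    proper   : ∀ u v → Arc u v → β u ≢ β v
    oriented : ∀ t u v w → Arc t u → Arc v w → (β t ≢ β w) ⊎ (β u ≢ β v)

next : {k : ℕ} → Fin (suc k) → Fin (suc k)
next {k} i = fromℕ< (m%n<n (suc (toℕ i)) (suc k))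

-- An oriented cycle on vertices v_0,…,v_{n-1} (n = suc k) is determined by
-- the direction of each arc: d i ≡ true means the arc (v_i , v_{i+1}) is
-- present (forward), d i ≡ false means (v_{i+1} , v_i) is present (backward).
CycleArc : {k : ℕ} → (Fin (suc k) → Bool) → Fin (suc k) → Fin (suc k) → Set
CycleArc d x y =
  Σ _ λ i → (d i ≡ true × x ≡ i × y ≡ next i) ⊎ (d i ≡ false × x ≡ next i × y ≡ i)

λarc : Bool → ℤ
λarc true  = + 1
λarc false = -[1+ 0 ]

sumℤ : (n : ℕ) → (Fin n → ℤ) → ℤ
sumℤ zero    f = + 0
sumℤ (suc n) f = f Fin.zero + sumℤ n (λ i → f (Fin.suc i))

λcycle : {k : ℕ} → (Fin (suc k) → Bool) → ℤ
λcycle {k} d = sumℤ (suc k) (λ i → λarc (d i))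

HasThreeConsecutiveSame : {k : ℕ} → (Fin (suc k) → Bool) → Set
HasThreeConsecutiveSame d =
  Σ _ λ i → d i ≡ d (next i) × d (next i) ≡ d (next (next i))

module Submission where

open import Defs
open import Data.Nat using (ℕ; suc; _≤_)
open import Data.Fin using (Fin)
open import Data.Bool using (Bool)
open import Data.Integer using (+_)
open import Data.Integer.Divisibility using (_∣_)
open import Data.Product using (Σ; _×_)
open import Data.Sum using (_⊎_)
open import Relation.Nullary using (¬_)

import Data.Nat as ℕ
open import Data.Nat using (zero; z<s; s<s)
open import Data.Nat.Divisibility using (divides) renaming (_∣_ to _∣ℕ_; _∣?_ to _∣ℕ?_)
open import Data.Nat.DivMod using (m<n⇒m%n≡m; n%n≡0)
open import Data.Fin using (zero; suc; toℕ; fromℕ; inject₁; _<_; _≟_)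
open import Data.Fin.Properties using (toℕ-injective; toℕ-fromℕ<; toℕ-fromℕ; toℕ-inject₁; toℕ<n; <-asym)
open import Data.Fin.Induction using (<-weakInduction)
open import Data.Fin.Relation.Unary.Top using (view; ‵fromℕ; ‵inject₁)
open import Data.Bool using (true; false)
open import Data.Integer using (ℤ; -[1+_]; _+_; ∣_∣)
open import Data.Product using (_,_; proj₂)
open import Data.Sum using (inj₁; inj₂; [_,_]′) renaming (map to ⊎-map)
open import Data.Empty using (⊥-elim)
open import Relation.Nullary using (yes; no)
open import Relation.Binary.Definitions using (Asymmetric)
open import Relation.Binary.PropositionalEquality
open import Function using (_∘_)
open import Function.Definitions using (Injective)

-- Colours form Fin 3, and rot is
-- their cyclic rotation 0 ↦ 1 ↦ 2 ↦ 0.  A rot-homomorphism is a colouring in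
-- which every arc (x , y) satisfies β y = rot (β x); since "b = rot a" is an
-- asymmetric relation, every rot-homomorphism is an oriented colouring.
--  (1) Rigidity: in an oriented 3-colouring of any oriented graph, a directed
--      path with three arcs shows an arc coloured (c , rot c) for every colour
--      c (for one of the two rotations), and such arcs forbid all arcs going
--      against the rotation; so, after possibly reflecting the colours, the
--      colouring is a rot-homomorphism.
--  (2) Holonomy: going once around the cycle, a rot-homomorphism shifts colours
--      by +1 along forward and by -1 along backward arcs; hence one exists iff
--      the total shift by λ(C) fixes a colour, i.e. iff 3 ∣ λ(C).
--  (3) Without three consecutive arcs in the same direction, colouring sources
--      0, sinks 2 and the remaining vertices 1 makes every arc increase.
-- The theorem combines (1)-(3).

Colour : Set
Colour = Fin 3

pattern 0F = zero
pattern 1F = suc zero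
pattern 2F = suc (suc zero)

rot : Colour → Colour
rot = next

rot⁻¹ : Colour → Colour
rot⁻¹ c = rot (rot c)

rot-cube : ∀ c → rot (rot (rot c)) ≡ c
rot-cube 0F = refl
rot-cube 1F = refl
rot-cube 2F = refl

rot-no-fixed-point : ∀ c → rot c ≢ c
rot-no-fixed-point 0F ()
rot-no-fixed-point 1F ()
rot-no-fixed-point 2F ()

rot⁻¹-no-fixed-point : ∀ c → rot⁻¹ c ≢ c
rot⁻¹-no-fixed-point 0F ()
rot⁻¹-no-fixed-point 1F ()
rot⁻¹-no-fixed-point 2F ()

rot-orbit : ∀ c x → c ≡ x ⊎ c ≡ rot x ⊎ c ≡ rot (rot x)
rot-orbit 0F 0F = inj₁ refl
rot-orbit 0F 1F = inj₂ (inj₂ refl)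
rot-orbit 0F 2F = inj₂ (inj₁ refl)
rot-orbit 1F 0F = inj₂ (inj₁ refl)
rot-orbit 1F 1F = inj₁ refl
rot-orbit 1F 2F = inj₂ (inj₂ refl)
rot-orbit 2F 0F = inj₂ (inj₂ refl)
rot-orbit 2F 1F = inj₂ (inj₁ refl)
rot-orbit 2F 2F = inj₁ refl

rot-tournament : ∀ {a b} → a ≢ b → b ≡ rot a ⊎ a ≡ rot b
rot-tournament {a} {b} a≢b with rot-orbit b a
... | inj₁ b≡a          = ⊥-elim (a≢b (sym b≡a))
... | inj₂ (inj₁ b≡ra)  = inj₁ b≡ra
... | inj₂ (inj₂ b≡rra) = inj₂ (trans (sym (rot-cube a)) (cong rot (sym b≡rra)))

third-colour : ∀ {c x} → c ≢ x → c ≢ rot x → c ≡ rot (rot x)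
third-colour {c} {x} c≢x c≢rx with rot-orbit c x
... | inj₁ c≡x          = ⊥-elim (c≢x c≡x)
... | inj₂ (inj₁ c≡rx)  = ⊥-elim (c≢rx c≡rx)
... | inj₂ (inj₂ c≡rrx) = c≡rrx

reflect : Colour → Colour
reflect 0F = 0F
reflect 1F = 2F
reflect 2F = 1F

reflect-involutive : ∀ c → reflect (reflect c) ≡ c
reflect-involutive 0F = refl
reflect-involutive 1F = refl
reflect-involutive 2F = refl

reflect-injective : Injective _≡_ _≡_ reflect
reflect-injective {a} {b} e =
  trans (sym (reflect-involutive a)) (trans (cong reflect e) (reflect-involutive b))

reflect-reverses : ∀ c → reflect c ≡ rot (reflect (rot c))
reflect-reverses 0F = refl
reflect-reverses 1F = refl
reflect-reverses 2F = refl

RotArc : Colour → Colour → Set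
RotArc a b = b ≡ rot a

rotArc-asym : Asymmetric RotArc
rotArc-asym {a} b≡ra a≡rb = rot⁻¹-no-fixed-point a (sym (trans a≡rb (cong rot b≡ra)))

RotHom : {V : Set} → (V → V → Set) → (V → Colour) → Set
RotHom Arc β = ∀ x y → Arc x y → RotArc (β x) (β y)

record DirectedPath {V : Set} (Arc : V → V → Set) : Set where
  field
    v₀ v₁ v₂ v₃ : V
    arc₀ : Arc v₀ v₁
    arc₁ : Arc v₁ v₂
    arc₂ : Arc v₂ v₃

module _ {V : Set} {Arc : V → V → Set} where

  -- A colouring mapping every arc into an asymmetric relation on the colours
  -- is oriented: two arcs with swapped colours would give R a b and R b a.
  hom⇒oriented : ∀ {k} {R : Fin k → Fin k → Set} → Asymmetric R →
                 (β : V → Fin k) → (∀ x y → Arc x y → R (β x) (β y)) →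
                 IsOrientedColoring Arc k β
  hom⇒oriented {R = R} asym β hom = record { proper = proper ; oriented = oriented }
    where
    proper : ∀ u v → Arc u v → β u ≢ β v
    proper u v a βu≡βv = asym (hom u v a) (subst₂ R βu≡βv (sym βu≡βv) (hom u v a))

    oriented : ∀ t u v w → Arc t u → Arc v w → (β t ≢ β w) ⊎ (β u ≢ β v)
    oriented t u v w a b with β u ≟ β v
    ... | no βu≢βv  = inj₂ βu≢βv
    ... | yes βu≡βv = inj₁ λ βt≡βw →
      asym (hom t u a) (subst₂ R (sym βu≡βv) (sym βt≡βw) (hom v w b))

  rotHom⇒oriented : ∀ {β} → RotHom Arc β → IsOrientedColoring Arc 3 β
  rotHom⇒oriented {β} = hom⇒oriented {R = RotArc} rotArc-asym β

  recolour : ∀ {k m} {β : V → Fin k} {π : Fin k → Fin m} → Injective _≡_ _≡_ π →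
             IsOrientedColoring Arc k β → IsOrientedColoring Arc m (π ∘ β)
  recolour π-inj col = record
    { proper   = λ u v a → proper u v a ∘ π-inj
    ; oriented = λ t u v w a b → ⊎-map (_∘ π-inj) (_∘ π-inj) (oriented t u v w a b)
    }
    where open IsOrientedColoring col

  module _ {k} {β : V → Fin k} (col : IsOrientedColoring Arc k β) where
    open IsOrientedColoring col

    two-step : ∀ {a b c} → Arc a b → Arc b c → β a ≢ β c
    two-step {a} {b} {c} p q =
      [ (λ βa≢βc → βa≢βc) , (λ βb≢βb → ⊥-elim (βb≢βb refl)) ]′ (oriented a b b c p q)

  module _ {β : V → Colour} (col : IsOrientedColoring Arc 3 β) where
    open IsOrientedColoring col

    -- Along v₀ → v₁ → v₂, rotating on the first arc forces rotating on the
    -- second, since β v₂ differs from β v₁ = rot (β v₀) and from β v₀.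
    rotation-propagates : ∀ {v₀ v₁ v₂} → Arc v₀ v₁ → Arc v₁ v₂ →
                          RotArc (β v₀) (β v₁) → RotArc (β v₁) (β v₂)
    rotation-propagates {v₀} {v₁} {v₂} a b r =
      trans (third-colour (two-step col a b ∘ sym) (λ e → proper v₁ v₂ b (sym (trans e (sym r)))))
            (cong rot (sym r))

    RotArcAt : Colour → Set
    RotArcAt c = Σ V λ t → Σ V λ u → Arc t u × β t ≡ c × β u ≡ rot c

    -- An arc coloured (c , rot c) forbids arcs coloured (rot c , c); so if
    -- every colour starts such an arc, every arc follows the rotation.
    rotArcs⇒rotHom : (∀ c → RotArcAt c) → RotHom Arc β
    rotArcs⇒rotHom rotArcAt y z a with rot-tournament (proper y z a)
    ... | inj₁ βz≡rβy = βz≡rβy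
    ... | inj₂ βy≡rβz with rotArcAt (β z)
    ...   | t , u , a′ , βt≡βz , βu≡rβz =
      [ (λ βt≢βz → ⊥-elim (βt≢βz βt≡βz))
      , (λ βu≢βy → ⊥-elim (βu≢βy (trans βu≡rβz (sym βy≡rβz)))) ]′ (oriented t u y z a′ a)

    -- A directed path with three arcs, rotating on its first arc, rotates on
    -- all three; their tails carry all three colours.
    rotating-path⇒rotHom : (p : DirectedPath Arc) → let open DirectedPath p in
                           RotArc (β v₀) (β v₁) → RotHom Arc β
    rotating-path⇒rotHom p r₀ = rotArcs⇒rotHom covers
      where
      open DirectedPath p
      r₁ = rotation-propagates arc₀ arc₁ r₀
      r₂ = rotation-propagates arc₁ arc₂ r₁

      rotArc : ∀ {t u c} → Arc t u → β t ≡ c → RotArc (β t) (β u) → RotArcAt c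
      rotArc {t} {u} a βt≡c r = t , u , a , βt≡c , trans r (cong rot βt≡c)

      covers : ∀ c → RotArcAt c
      covers c with rot-orbit c (β v₀)
      ... | inj₁ c≡x          = rotArc arc₀ (sym c≡x) r₀
      ... | inj₂ (inj₁ c≡rx)  = rotArc arc₁ (trans r₀ (sym c≡rx)) r₁
      ... | inj₂ (inj₂ c≡rrx) = rotArc arc₂ (trans r₁ (trans (cong rot r₀) (sym c≡rrx))) r₂

  rigidity : ∀ {β} → IsOrientedColoring Arc 3 β → DirectedPath Arc →
             Σ (V → Colour) (RotHom Arc)
  rigidity {β} col p with rot-tournament (IsOrientedColoring.proper col _ _ (DirectedPath.arc₀ p))
  ... | inj₁ β₁≡rβ₀ = β , rotating-path⇒rotHom col p β₁≡rβ₀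
  ... | inj₂ β₀≡rβ₁ = reflect ∘ β , rotating-path⇒rotHom (recolour reflect-injective col) p
    (trans (reflect-reverses (β (DirectedPath.v₁ p))) (cong (rot ∘ reflect) (sym β₀≡rβ₁)))

iterate : {A : Set} → (A → A) → ℕ → A → A
iterate f zero    x = x
iterate f (suc n) x = f (iterate f n x)

iterate-commutes : ∀ {A : Set} {f g : A → A} → (∀ x → g (f x) ≡ f (g x)) →
                   ∀ n x → iterate g n (f x) ≡ f (iterate g n x)
iterate-commutes             g∘f≡f∘g zero    x = refl
iterate-commutes {f = f} {g} g∘f≡f∘g (suc n) x =
  trans (cong g (iterate-commutes {f = f} g∘f≡f∘g n x)) (g∘f≡f∘g _)

module _ {A : Set} (f : A → A) (cube : ∀ x → f (f (f x)) ≡ x) where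

  divisible⇒iterate-fixed : ∀ {n} x → 3 ∣ℕ n → iterate f n x ≡ x
  divisible⇒iterate-fixed x (divides q refl) = go q
    where
    go : ∀ q → iterate f (q ℕ.* 3) x ≡ x
    go zero    = refl
    go (suc q) = trans (cube _) (go q)

  iterate-fixed⇒divisible : (∀ x → f x ≢ x) → (∀ x → f (f x) ≢ x) →
                            ∀ n x → iterate f n x ≡ x → 3 ∣ℕ n
  iterate-fixed⇒divisible no-fix₁ no-fix₂ = go
    where
    go : ∀ n x → iterate f n x ≡ x → 3 ∣ℕ n
    go 0                   x _   = divides 0 refl
    go 1                   x fix = ⊥-elim (no-fix₁ x fix)
    go 2                   x fix = ⊥-elim (no-fix₂ x fix)
    go (suc (suc (suc n))) x fix with go n x (trans (sym (cube _)) fix)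
    ... | divides q n≡q*3 = divides (suc q) (cong (3 ℕ.+_) n≡q*3)

shift : ℤ → Colour → Colour
shift (+ n)    = iterate rot n
shift -[1+ n ] = iterate rot⁻¹ (suc n)

shift-step : ∀ b z c → shift (λarc b + z) c ≡ shift (λarc b) (shift z c)
shift-step true  (+ n)          c = refl
shift-step true  -[1+ 0 ]       c = sym (rot-cube c)
shift-step true  -[1+ suc n ]   c = sym (rot-cube _)
shift-step false (+ 0)          c = refl
shift-step false (+ suc n)      c = sym (rot-cube _)
shift-step false -[1+ n ]       c = refl

shift-rot : ∀ z c → shift z (rot c) ≡ rot (shift z c)
shift-rot (+ n)    = iterate-commutes {f = rot} {g = rot} (λ _ → refl) n
shift-rot -[1+ n ] = iterate-commutes {f = rot} {g = rot⁻¹} (λ _ → refl) (suc n)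

shift-commutes : ∀ b z c → shift z (shift (λarc b) c) ≡ shift (λarc b) (shift z c)
shift-commutes true  z c = shift-rot z c
shift-commutes false z c = trans (shift-rot z (rot c)) (cong rot (shift-rot z c))

rot⁻¹-cube : ∀ c → rot⁻¹ (rot⁻¹ (rot⁻¹ c)) ≡ c
rot⁻¹-cube c = trans (rot-cube _) (rot-cube c)

shift-fixed⇒divisible : ∀ z c → shift z c ≡ c → + 3 ∣ z
shift-fixed⇒divisible (+ n) =
  iterate-fixed⇒divisible rot rot-cube rot-no-fixed-point rot⁻¹-no-fixed-point n
shift-fixed⇒divisible -[1+ n ] =
  iterate-fixed⇒divisible rot⁻¹ rot⁻¹-cube rot⁻¹-no-fixed-point
    (λ c e → rot-no-fixed-point c (trans (sym (rot-cube (rot c))) e)) (suc n)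

divisible⇒shift-fixed : ∀ z c → + 3 ∣ z → shift z c ≡ c
divisible⇒shift-fixed (+ n)    = divisible⇒iterate-fixed rot rot-cube
divisible⇒shift-fixed -[1+ n ] = divisible⇒iterate-fixed rot⁻¹ rot⁻¹-cube

walk : ∀ {A : Set} {n} → (Fin n → A → A) → Fin (suc n) → A → A
walk             φ zero    x = x
walk {n = suc n} φ (suc j) x = walk (φ ∘ suc) j (φ zero x)

walk-last-step : ∀ {A : Set} {n} (φ : Fin n → A → A) (j : Fin n) x →
                 walk φ (suc j) x ≡ φ j (walk φ (inject₁ j) x)
walk-last-step φ zero    x = refl
walk-last-step φ (suc j) x = walk-last-step (φ ∘ suc) j (φ zero x)

next-inject₁ : ∀ {k} (j : Fin k) → next (inject₁ j) ≡ suc j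
next-inject₁ {k} j = toℕ-injective (begin
  toℕ (next (inject₁ j))         ≡⟨ toℕ-fromℕ< _ ⟩
  suc (toℕ (inject₁ j)) ℕ.% suc k ≡⟨ m<n⇒m%n≡m (s<s (subst (ℕ._< k) (sym (toℕ-inject₁ j)) (toℕ<n j))) ⟩
  suc (toℕ (inject₁ j))           ≡⟨ cong suc (toℕ-inject₁ j) ⟩
  suc (toℕ j)                     ∎)
  where open ≡-Reasoning

next-fromℕ : ∀ k → next (fromℕ k) ≡ zero
next-fromℕ k = toℕ-injective (begin
  toℕ (next (fromℕ k))         ≡⟨ toℕ-fromℕ< _ ⟩
  suc (toℕ (fromℕ k)) ℕ.% suc k ≡⟨ cong (λ m → suc m ℕ.% suc k) (toℕ-fromℕ k) ⟩
  suc k ℕ.% suc k               ≡⟨ n%n≡0 (suc k) ⟩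
  0                             ∎)
  where open ≡-Reasoning

module _ {A : Set} {k : ℕ} (φ : Fin (suc k) → A → A) where

  holonomy : A → A
  holonomy = walk φ (fromℕ (suc k))

  Follows : (Fin (suc k) → A) → Set
  Follows γ = ∀ i → γ (next i) ≡ φ i (γ i)

  -- A labelling that follows φ is a walk from γ zero, so after a full turn
  -- it returns: γ zero is a fixed point of the holonomy.
  follows⇒fixed : ∀ γ → Follows γ → holonomy (γ zero) ≡ γ zero
  follows⇒fixed γ follows = begin
    walk φ (suc (fromℕ k)) (γ zero)        ≡⟨ walk-last-step φ (fromℕ k) (γ zero) ⟩
    φ last (walk φ (inject₁ last) (γ zero)) ≡⟨ cong (φ last) (sym (γ-is-walk last)) ⟩
    φ last (γ last)                         ≡⟨ sym (follows last) ⟩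
    γ (next last)                           ≡⟨ cong γ (next-fromℕ k) ⟩
    γ zero                                  ∎
    where
    open ≡-Reasoning
    last = fromℕ k

    γ-is-walk : ∀ j → γ j ≡ walk φ (inject₁ j) (γ zero)
    γ-is-walk = <-weakInduction _ refl λ i γi≡walk →
      trans (cong γ (sym (next-inject₁ i)))
        (trans (follows (inject₁ i))
          (trans (cong (φ (inject₁ i)) γi≡walk)
            (sym (walk-last-step φ (inject₁ i) (γ zero)))))

  fixed⇒follows : ∀ x → holonomy x ≡ x → Follows (λ j → walk φ (inject₁ j) x)
  fixed⇒follows x fixed i with view i
  ... | ‵fromℕ = begin
    walk φ (inject₁ (next (fromℕ k))) x        ≡⟨ cong (λ j → walk φ (inject₁ j) x) (next-fromℕ k) ⟩
    x                                          ≡⟨ sym fixed ⟩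
    walk φ (suc (fromℕ k)) x                   ≡⟨ walk-last-step φ (fromℕ k) x ⟩
    φ (fromℕ k) (walk φ (inject₁ (fromℕ k)) x) ∎
    where open ≡-Reasoning
  ... | ‵inject₁ j =
    trans (cong (λ j → walk φ (inject₁ j) x) (next-inject₁ j)) (walk-last-step φ (inject₁ j) x)

walk-shift : ∀ n (d : Fin n → Bool) c →
             walk (λ i → shift (λarc (d i))) (fromℕ n) c ≡ shift (sumℤ n (λ i → λarc (d i))) c
walk-shift zero    d c = refl
walk-shift (suc n) d c = begin
  walk (λ i → shift (λarc (d (suc i)))) (fromℕ n) (shift (λarc (d zero)) c)
    ≡⟨ walk-shift n (d ∘ suc) _ ⟩
  shift rest (shift (λarc (d zero)) c)   ≡⟨ shift-commutes (d zero) rest c ⟩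
  shift (λarc (d zero)) (shift rest c)   ≡⟨ sym (shift-step (d zero) rest c) ⟩
  shift (λarc (d zero) + rest) c         ∎
  where
  open ≡-Reasoning
  rest = sumℤ n (λ i → λarc (d (suc i)))

module _ {k : ℕ} (d : Fin (suc k) → Bool) where

  arcShift : Fin (suc k) → Colour → Colour
  arcShift i = shift (λarc (d i))

  rotHom⇒follows : ∀ {γ} → RotHom (CycleArc d) γ → Follows arcShift γ
  rotHom⇒follows {γ} hom i with d i in di
  ... | true  = hom i (next i) (i , inj₁ (di , refl , refl))
  ... | false = sym (trans (cong (rot ∘ rot) (hom (next i) i (i , inj₂ (di , refl , refl))))
                           (rot-cube _))

  follows⇒rotHom : ∀ {γ} → Follows arcShift γ → RotHom (CycleArc d) γ
  follows⇒rotHom {γ} follows x y (i , inj₁ (di , refl , refl)) =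
    trans (follows i) (cong (λ b → shift (λarc b) (γ i)) di)
  follows⇒rotHom {γ} follows x y (i , inj₂ (di , refl , refl)) =
    sym (trans (cong rot (trans (follows i) (cong (λ b → shift (λarc b) (γ i)) di))) (rot-cube (γ i)))

  -- The holonomy of the cycle is the shift by λ(C); so a rot-homomorphism
  -- exists iff this shift has a fixed point, i.e. iff 3 ∣ λ(C).
  rotHom⇒divisible : ∀ {γ} → RotHom (CycleArc d) γ → + 3 ∣ λcycle d
  rotHom⇒divisible {γ} hom = shift-fixed⇒divisible (λcycle d) (γ zero)
    (trans (sym (walk-shift (suc k) d (γ zero))) (follows⇒fixed arcShift γ (rotHom⇒follows hom)))

  divisible⇒rotHom : + 3 ∣ λcycle d → Σ (Fin (suc k) → Colour) (RotHom (CycleArc d))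
  divisible⇒rotHom 3∣λ = _ , follows⇒rotHom (fixed⇒follows arcShift 0F
    (trans (walk-shift (suc k) d 0F) (divisible⇒shift-fixed (λcycle d) 0F 3∣λ)))

  three⇒directedPath : HasThreeConsecutiveSame d → DirectedPath (CycleArc d)
  three⇒directedPath (i , p , q) with d i in di
  ... | true = record
    { v₀ = i ; v₁ = next i ; v₂ = next (next i) ; v₃ = next (next (next i))
    ; arc₀ = i               , inj₁ (di , refl , refl)
    ; arc₁ = next i          , inj₁ (sym p , refl , refl)
    ; arc₂ = next (next i)   , inj₁ (sym (trans p q) , refl , refl)
    }
  ... | false = record
    { v₀ = next (next (next i)) ; v₁ = next (next i) ; v₂ = next i ; v₃ = i
    ; arc₀ = next (next i)   , inj₂ (sym (trans p q) , refl , refl)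
    ; arc₁ = next i          , inj₂ (sym p , refl , refl)
    ; arc₂ = i               , inj₂ (di , refl , refl)
    }

prev : ∀ {k} → Fin (suc k) → Fin (suc k)
prev {k} zero = fromℕ k
prev (suc j)  = inject₁ j

next-prev : ∀ {k} (i : Fin (suc k)) → next (prev i) ≡ i
next-prev {k} zero = next-fromℕ k
next-prev (suc j)  = next-inject₁ j

prev-next : ∀ {k} (i : Fin (suc k)) → prev (next i) ≡ i
prev-next {k} i with view i
... | ‵fromℕ     = cong prev (next-fromℕ k)
... | ‵inject₁ j = cong prev (next-inject₁ j)

-- The level of a vertex from the directions of the arc entering it from
-- behind (true: forward) and the arc leaving it ahead: sources 0, sinks 2,
-- all other vertices 1.
level : Bool → Bool → Colour
level false true  = 0F
level true  false = 2F
level true  true  = 1F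
level false false = 1F

-- An arc raises the level unless it is the middle of three equal arcs.
level-forward : ∀ a c → ¬ (a ≡ true × c ≡ true) → level a true < level true c
level-forward false true  _  = z<s
level-forward false false _  = z<s
level-forward true  false _  = s<s z<s
level-forward true  true  ¬p = ⊥-elim (¬p (refl , refl))

level-backward : ∀ a c → ¬ (a ≡ false × c ≡ false) → level false c < level a false
level-backward true  true  _  = z<s
level-backward false true  _  = z<s
level-backward true  false _  = s<s z<s
level-backward false false ¬p = ⊥-elim (¬p (refl , refl))

module _ {k : ℕ} (d : Fin (suc k) → Bool) where

  -- Vertex v is joined to its neighbours by the arcs prev v and v.
  levelColouring : Fin (suc k) → Colour
  levelColouring v = level (d (prev v)) (d v)

  consecutive : ∀ {b} i → d (prev i) ≡ b → d i ≡ b → d (next i) ≡ b → HasThreeConsecutiveSame d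
  consecutive i e₁ e₂ e₃ = prev i
    , trans e₁ (sym (trans (cong d (next-prev i)) e₂))
    , trans (trans (cong d (next-prev i)) e₂) (sym (trans (cong (d ∘ next) (next-prev i)) e₃))

  level-increases : ¬ HasThreeConsecutiveSame d →
                    ∀ x y → CycleArc d x y → levelColouring x < levelColouring y
  level-increases no-three x y (i , inj₁ (di , refl , refl)) rewrite prev-next i | di =
    level-forward (d (prev i)) (d (next i)) λ { (e₁ , e₃) → no-three (consecutive i e₁ di e₃) }
  level-increases no-three x y (i , inj₂ (di , refl , refl)) rewrite prev-next i | di =
    level-backward (d (prev i)) (d (next i)) λ { (e₁ , e₃) → no-three (consecutive i e₁ di e₃) }

lemma5 : (k : ℕ) → 3 ≤ suc k → (d : Fin (suc k) → Bool) →
         (Σ (Fin (suc k) → Fin 3) (λ β → IsOrientedColoring (CycleArc d) 3 β)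
           → ((+ 3) ∣ λcycle d) ⊎ ¬ HasThreeConsecutiveSame d)
         × (((+ 3) ∣ λcycle d) ⊎ ¬ HasThreeConsecutiveSame d
           → Σ (Fin (suc k) → Fin 3) (λ β → IsOrientedColoring (CycleArc d) 3 β))
lemma5 k _ d = colourable⇒condition , condition⇒colourable
  where
  -- If 3 ∤ λ(C), three consecutive equal arcs would give a directed path,
  -- hence by rigidity a rot-homomorphism, hence 3 ∣ λ(C).
  colourable⇒condition : Σ (Fin (suc k) → Fin 3) (IsOrientedColoring (CycleArc d) 3) →
                         ((+ 3) ∣ λcycle d) ⊎ ¬ HasThreeConsecutiveSame d
  colourable⇒condition (β , col) with 3 ∣ℕ? ∣ λcycle d ∣
  ... | yes 3∣λ = inj₁ 3∣λ
  ... | no  3∤λ = inj₂ λ three →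
    3∤λ (rotHom⇒divisible d (proj₂ (rigidity col (three⇒directedPath d three))))

  condition⇒colourable : ((+ 3) ∣ λcycle d) ⊎ ¬ HasThreeConsecutiveSame d →
                         Σ (Fin (suc k) → Fin 3) (IsOrientedColoring (CycleArc d) 3)
  condition⇒colourable (inj₁ 3∣λ) with divisible⇒rotHom d 3∣λ
  ... | γ , hom = γ , rotHom⇒oriented hom
  condition⇒colourable (inj₂ no-three) =
    levelColouring d , hom⇒oriented {R = _<_} <-asym (levelColouring d) (level-increases d no-three)
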